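{- Let $n\ge 1$, $k\ge 0$ and $k+1\le l\le n+k-1$ be integers. Then $$p^l_{n,n+k;\le n+k}-p^{l+1}_{n,n+k;\le n+k}=\binom{n-1}{l-k-1}\,p_{l-k-1,\,l-1;\le l-1}\,p_{n+k-l}.$$
   Context: Parking model: there are $m$ parking spaces in a line, numbered $1,\dots,m$. A preference set of length $n$ is a sequence $(a_1,\dots,a_n)$ of integers with $1\le a_i\le m$; cars $1,\dots,n$ arrive in order, car $i$ parks in the first unoccupied space numbered $\ge a_i$ if one exists, otherwise it fails to park. A parking function is a preference set in which all cars park. $p_{n,m;\le s}$ denotes the number of parking functions of length $n$ with $m$ spaces and all $a_i\le s$, and $p^l_{n,m;\le s}$ the number of those with $a_1=l$. $p_j$ denotes the number of parking functions of length $j$ with $j$ spaces, $p_j=(j+1)^{j-1}$. The empty sequence (length $0$) counts as a parking function, so $p_{0,m;\le s}=1$ and $p_0=1$. -}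

module Defs where

open import Data.Nat using (ℕ; zero; suc; _+_; _*_; _^_)
open import Data.Bool using (Bool; true; false; if_then_else_)
open import Data.Maybe using (Maybe; just; nothing)
open import Data.List using (List; []; _∷_; map; concatMap; length; filter)
open import Data.List using (upTo)
open import Relation.Nullary.Decidable using (⌊_⌋)
open import Data.Nat using (_≟_)

-- Occupancy of spaces 1..m as a list of Bools (true = occupied); the
-- head is space 1.
-- Park one car with preference a (1-based) into the first free space
-- with number ≥ a; nothing if there is none.
parkFrom : ℕ → List Bool → Maybe (List Bool)
parkFrom _ [] = nothing
parkFrom (suc (suc a)) (b ∷ bs) with parkFrom (suc a) bs
... | just bs' = just (b ∷ bs')
... | nothing = nothing
parkFrom _ (true ∷ bs) with parkFrom 1 bs
... | just bs' = just (true ∷ bs')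
... | nothing = nothing
parkFrom _ (false ∷ bs) = just (true ∷ bs)

emptyLot : ℕ → List Bool
emptyLot zero = []
emptyLot (suc m) = false ∷ emptyLot m

runCars : List ℕ → List Bool → Maybe (List Bool)
runCars [] occ = just occ
runCars (a ∷ as) occ with parkFrom a occ
... | just occ' = runCars as occ'
... | nothing = nothing

isParkingFunction : ℕ → List ℕ → Bool
isParkingFunction m as with runCars as (emptyLot m)
... | just _ = true
... | nothing = false

prefSets : ℕ → ℕ → List (List ℕ)
prefSets zero s = [] ∷ []
prefSets (suc n) s =
  concatMap (λ a → map (a ∷_) (prefSets n s)) (map suc (upTo s))

countTrue : {A : Set} → (A → Bool) → List A → ℕ
countTrue f [] = 0
countTrue f (x ∷ xs) = (if f x then 1 else 0) + countTrue f xs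

-- p_{n,m;≤s}: parking functions of length n, m spaces, all a_i ≤ s
-- (preferences range over 1..s; the model needs a_i ≤ m, all uses have s ≤ m).
p≤ : ℕ → ℕ → ℕ → ℕ
p≤ n m s = countTrue (isParkingFunction m) (prefSets n s)

firstIs : ℕ → List ℕ → Bool
firstIs l [] = false
firstIs l (a ∷ _) = ⌊ a ≟ l ⌋

pˡ≤ : ℕ → ℕ → ℕ → ℕ → ℕ
pˡ≤ l n m s = countTrue (λ as → if firstIs l as then isParkingFunction m as else false)
                        (prefSets n s)

pPF : ℕ → ℕ
pPF j = p≤ j j j

-- Write l = L + 1 for the first preference, n + k = l + r for the number of spaces (so r ≥ 1)
-- and s = L − k, so that the other n − 1 = r + s cars remain. A list of positive preferences
-- is a parking function for m spaces iff for every j ≤ m at most m − j cars prefer a space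
-- beyond j. Raising the first preference from l to l + 1 only changes the test at j = l, so
-- the difference counts the parking functions with a₁ = l in which exactly r of the other
-- cars prefer a space beyond l. Those r cars, with preferences lowered by l, must then form a
-- parking function on r spaces and the remaining s cars one on l − 1 spaces; conversely every
-- such pair, interleaved in one of C(r + s, s) ways, is counted.

module Submission where

open import Defs
open import Data.Nat
  using (ℕ; zero; suc; _+_; _*_; _∸_; _≤_; _<_; _<ᵇ_; _≤ᵇ_; _≡ᵇ_; _<?_; _≤?_; _≟_; z≤n; s≤s; z<s; s<s)
open import Data.Nat.Properties
open import Data.Nat.Combinatorics using (_C_; nCn≡1; nCk≡nC[n∸k]; nCk+nC[k+1]≡[n+1]C[k+1])
open import Data.Nat.Tactic.RingSolver using (solve-∀)
open import Data.Bool using (Bool; true; false; not; T; T?; _∧_; if_then_else_)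
open import Data.Bool.Properties using (T-∧; T-≡; T-not-≡; ∧-identityʳ)
open import Data.Bool.ListAction using (all)
open import Data.Maybe using (just)
open import Data.List using (List; []; _∷_; _++_; map; concatMap; length; filterᵇ; applyUpTo; upTo)
open import Data.List.Properties using (length-map; map-id)
open import Data.List.Relation.Unary.All as All using (All; []; _∷_)
open import Data.List.Relation.Unary.All.Properties as All
  using (all-filter; filter⁺; concat⁺; map⁺; applyUpTo⁺₁)
open import Data.Product using (∃; _×_; _,_; proj₁; proj₂; map₂)
open import Data.Empty using (⊥-elim)
open import Function using (_∘_; id; _⇔_; mk⇔; Equivalence)
open import Relation.Nullary using (¬_; yes; no)
open import Relation.Nullary.Reflects using (ofʸ; ofⁿ)
open import Relation.Nullary.Negation using (contradiction)
open import Relation.Binary using (tri<; tri≈; tri>)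
open import Relation.Binary.PropositionalEquality
open import Algebra.Properties.CommutativeSemigroup +-commutativeSemigroup
  using (x∙yz≈y∙xz) renaming (interchange to +-interchange)
open import Algebra.Properties.CommutativeSemigroup *-commutativeSemigroup
  using () renaming (xy∙z≈xz∙y to *-right-comm)
open Equivalence using (to; from)
open ≡-Reasoning

𝟙 : Bool → ℕ
𝟙 b = if b then 1 else 0

𝟙-∧ : ∀ x y → 𝟙 (x ∧ y) ≡ 𝟙 x * 𝟙 y
𝟙-∧ true y = sym (+-identityʳ (𝟙 y))
𝟙-∧ false y = refl

𝟙-split : ∀ x y e → (T y → T x) → T e ⇔ (T x × ¬ T y) → 𝟙 x ≡ 𝟙 y + 𝟙 e
𝟙-split false false false _ _ = refl
𝟙-split false false true _ e = ⊥-elim (proj₁ (to e _))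
𝟙-split false true _ y⇒x _ = ⊥-elim (y⇒x _)
𝟙-split true false false _ e = ⊥-elim (from e (_ , λ ()))
𝟙-split true false true _ _ = refl
𝟙-split true true false _ _ = refl
𝟙-split true true true _ e = ⊥-elim (proj₂ (to e _) _)

T-≡ᵇ : ∀ m n → T (m ≡ᵇ n) ⇔ m ≡ n
T-≡ᵇ m n = mk⇔ (≡ᵇ⇒≡ m n) (≡⇒≡ᵇ m n)

all≡true : ∀ (p : ℕ → Bool) u → All (λ a → p a ≡ true) u → all p u ≡ true
all≡true p [] [] = refl
all≡true p (a ∷ u) (pa ∷ ps) rewrite pa = all≡true p u ps

<ᵇ≡true : ∀ {m n} → m < n → (m <ᵇ n) ≡ true
<ᵇ≡true {m} {n} m<n with m <ᵇ n | <ᵇ-reflects-< m n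
... | true | _ = refl
... | false | ofⁿ m≮n = contradiction m<n m≮n

<ᵇ≡false : ∀ {m n} → n ≤ m → (m <ᵇ n) ≡ false
<ᵇ≡false {m} {n} n≤m with m <ᵇ n | <ᵇ-reflects-< m n
... | false | _ = refl
... | true | ofʸ m<n = contradiction n≤m (<⇒≱ m<n)

<ᵇ-shift : ∀ t l a → (t + l <ᵇ a) ≡ (t <ᵇ a ∸ l)
<ᵇ-shift t l a with t + l <? a
... | yes t+l<a = trans (<ᵇ≡true t+l<a) (sym (<ᵇ≡true (m+n≤o⇒m≤o∸n (suc t) t+l<a)))
... | no t+l≮a = trans (<ᵇ≡false a≤t+l) (sym (<ᵇ≡false a∸l≤t))
  where
  a≤t+l = ≮⇒≥ t+l≮a
  a∸l≤t = subst (a ∸ l ≤_) (m+n∸n≡m t l) (∸-monoˡ-≤ l a≤t+l)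

<ᵇ-suc : ∀ {j x} → j ≢ x → (j <ᵇ suc x) ≡ (j <ᵇ x)
<ᵇ-suc {j} {x} j≢x with <-cmp j x
... | tri< j<x _ _ = trans (<ᵇ≡true (m<n⇒m<1+n j<x)) (sym (<ᵇ≡true j<x))
... | tri≈ _ j≡x _ = contradiction j≡x j≢x
... | tri> _ _ x<j = trans (<ᵇ≡false x<j) (sym (<ᵇ≡false (<⇒≤ x<j)))

𝟙-<ᵇ-mono : ∀ j {x y} → x ≤ y → 𝟙 (j <ᵇ x) ≤ 𝟙 (j <ᵇ y)
𝟙-<ᵇ-mono j {x} x≤y with j <ᵇ x | <ᵇ-reflects-< j x
... | false | _ = z≤n
... | true | ofʸ j<x rewrite <ᵇ≡true (<-≤-trans j<x x≤y) = ≤-refl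

∑ : {A : Set} → List A → (A → ℕ) → ℕ
∑ [] f = 0
∑ (x ∷ xs) f = f x + ∑ xs f

infix 6.5 ∑ ∑<
syntax ∑ xs (λ x → e) = ∑[ x ∈ xs ] e

∑-++ : {A : Set} (xs ys : List A) (f : A → ℕ) → ∑ (xs ++ ys) f ≡ ∑ xs f + ∑ ys f
∑-++ [] ys f = refl
∑-++ (x ∷ xs) ys f = trans (cong (f x +_) (∑-++ xs ys f)) (sym (+-assoc (f x) _ _))

∑-concatMap : {A B : Set} (g : A → List B) (xs : List A) (f : B → ℕ) →
  ∑ (concatMap g xs) f ≡ ∑[ x ∈ xs ] ∑ (g x) f
∑-concatMap g [] f = refl
∑-concatMap g (x ∷ xs) f = trans (∑-++ (g x) _ f) (cong (∑ (g x) f +_) (∑-concatMap g xs f))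

∑-map : {A B : Set} (g : A → B) (xs : List A) (f : B → ℕ) → ∑ (map g xs) f ≡ ∑ xs (f ∘ g)
∑-map g [] f = refl
∑-map g (x ∷ xs) f = cong (f (g x) +_) (∑-map g xs f)

∑-cong : {A : Set} {P : A → Set} {f g : A → ℕ} (xs : List A) → All P xs →
  (∀ {x} → P x → f x ≡ g x) → ∑ xs f ≡ ∑ xs g
∑-cong [] [] e = refl
∑-cong (x ∷ xs) (px ∷ pxs) e = cong₂ _+_ (e px) (∑-cong xs pxs e)

∑-ext : {A : Set} {f g : A → ℕ} (xs : List A) → (∀ x → f x ≡ g x) → ∑ xs f ≡ ∑ xs g
∑-ext [] e = refl
∑-ext (x ∷ xs) e = cong₂ _+_ (e x) (∑-ext xs e)

∑-+ : {A : Set} (xs : List A) (f g : A → ℕ) → ∑[ x ∈ xs ] (f x + g x) ≡ ∑ xs f + ∑ xs g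
∑-+ [] f g = refl
∑-+ (x ∷ xs) f g = trans (cong (f x + g x +_) (∑-+ xs f g)) (+-interchange (f x) (g x) _ _)

∑-* : {A : Set} (c : ℕ) (xs : List A) (f : A → ℕ) → ∑[ x ∈ xs ] (c * f x) ≡ c * ∑ xs f
∑-* c [] f = sym (*-zeroʳ c)
∑-* c (x ∷ xs) f = trans (cong (c * f x +_) (∑-* c xs f)) (sym (*-distribˡ-+ c (f x) _))

∑-zero : {A : Set} (xs : List A) → ∑[ x ∈ xs ] 0 ≡ 0
∑-zero [] = refl
∑-zero (x ∷ xs) = ∑-zero xs

∑< : ℕ → (ℕ → ℕ) → ℕ
∑< zero h = 0
∑< (suc M) h = h 0 + ∑< M (h ∘ suc)

syntax ∑< M (λ a → e) = ∑[ a < M ] e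

∑-applyUpTo : {A : Set} (g : ℕ → A) (M : ℕ) (f : A → ℕ) → ∑ (applyUpTo g M) f ≡ ∑< M (f ∘ g)
∑-applyUpTo g zero f = refl
∑-applyUpTo g (suc M) f = cong (f (g 0) +_) (∑-applyUpTo (g ∘ suc) M f)

∑<-cong : ∀ M {h k : ℕ → ℕ} → (∀ {a} → a < M → h a ≡ k a) → ∑< M h ≡ ∑< M k
∑<-cong zero e = refl
∑<-cong (suc M) e = cong₂ _+_ (e z<s) (∑<-cong M (e ∘ s<s))

∑<-+ : ∀ M (h k : ℕ → ℕ) → ∑[ a < M ] (h a + k a) ≡ ∑< M h + ∑< M k
∑<-+ zero h k = refl
∑<-+ (suc M) h k = trans (cong (h 0 + k 0 +_) (∑<-+ M (h ∘ suc) (k ∘ suc))) (+-interchange (h 0) (k 0) _ _)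

∑<-* : ∀ M c (h : ℕ → ℕ) → ∑[ a < M ] (c * h a) ≡ c * ∑< M h
∑<-* zero c h = sym (*-zeroʳ c)
∑<-* (suc M) c h = trans (cong (c * h 0 +_) (∑<-* M c (h ∘ suc))) (sym (*-distribˡ-+ c (h 0) _))

∑<-zero : ∀ M {h : ℕ → ℕ} → (∀ {a} → a < M → h a ≡ 0) → ∑< M h ≡ 0
∑<-zero M e = trans (∑<-cong M e) (zeroes M)
  where
  zeroes : ∀ M → ∑[ a < M ] 0 ≡ 0
  zeroes zero = refl
  zeroes (suc M) = zeroes M

∑<-split : ∀ L R (h : ℕ → ℕ) → ∑< (L + R) h ≡ ∑< L h + ∑[ c < R ] h (L + c)
∑<-split zero R h = refl
∑<-split (suc L) R h = trans (cong (h 0 +_) (∑<-split L R (h ∘ suc))) (sym (+-assoc (h 0) _ _))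

∑<-single : ∀ M j {h : ℕ → ℕ} → j < M → (∀ {a} → a < M → a ≢ j → h a ≡ 0) → ∑< M h ≡ h j
∑<-single (suc M) zero {h} _ e = trans (cong (h 0 +_) (∑<-zero M (λ a<M → e (s<s a<M) λ ()))) (+-identityʳ _)
∑<-single (suc M) (suc j) {h} (s<s j<M) e =
  trans (cong (_+ ∑< M (h ∘ suc)) (e z<s λ ()))
        (∑<-single M j j<M (λ a<M a≢j → e (s<s a<M) (a≢j ∘ suc-injective)))

countTrue≡∑ : {A : Set} (f : A → Bool) (xs : List A) → countTrue f xs ≡ ∑[ x ∈ xs ] 𝟙 (f x)
countTrue≡∑ f [] = refl
countTrue≡∑ f (x ∷ xs) = cong (𝟙 (f x) +_) (countTrue≡∑ f xs)

Letter : ℕ → ℕ → Set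
Letter M a = 1 ≤ a × a ≤ M

Word : ℕ → ℕ → List ℕ → Set
Word N M w = length w ≡ N × All (Letter M) w

prefSets-Word : ∀ N M → All (Word N M) (prefSets N M)
prefSets-Word zero M = (refl , []) ∷ []
prefSets-Word (suc N) M =
  concat⁺ (map⁺ (map⁺ (applyUpTo⁺₁ id M λ a<M →
    map⁺ (All.map (λ (len , letters) → cong suc len , (s≤s z≤n , a<M) ∷ letters) (prefSets-Word N M)))))

∑-prefSets-suc : ∀ N M (f : List ℕ → ℕ) →
  ∑ (prefSets (suc N) M) f ≡ ∑[ a < M ] ∑[ w ∈ prefSets N M ] f (suc a ∷ w)
∑-prefSets-suc N M f = begin
  ∑ (concatMap (λ a → map (a ∷_) (prefSets N M)) (map suc (upTo M))) f
    ≡⟨ ∑-concatMap _ (map suc (upTo M)) f ⟩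
  ∑[ a ∈ map suc (upTo M) ] ∑ (map (a ∷_) (prefSets N M)) f
    ≡⟨ ∑-map suc (upTo M) _ ⟩
  ∑[ a ∈ upTo M ] ∑ (map (suc a ∷_) (prefSets N M)) f
    ≡⟨ ∑-applyUpTo id M _ ⟩
  ∑[ a < M ] ∑ (map (suc a ∷_) (prefSets N M)) f
    ≡⟨ ∑<-cong M (λ {a} _ → ∑-map (suc a ∷_) (prefSets N M) f) ⟩
  ∑[ a < M ] ∑[ w ∈ prefSets N M ] f (suc a ∷ w) ∎

-- Interleaving two alphabets

∑All : (ℕ → Bool) → ℕ → ℕ → (List ℕ → ℕ) → ℕ
∑All P N M F = ∑[ u ∈ prefSets N M ] 𝟙 (all P u) * F u

∑All-suc : ∀ P N M F → ∑All P (suc N) M F ≡ ∑[ a < M ] 𝟙 (P (suc a)) * ∑All P N M (F ∘ (suc a ∷_))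
∑All-suc P N M F = trans (∑-prefSets-suc N M _) (∑<-cong M λ {a} _ →
  trans (∑-ext (prefSets N M) λ w →
           trans (cong (_* F (suc a ∷ w)) (𝟙-∧ (P (suc a)) (all P w))) (*-assoc (𝟙 (P (suc a))) _ _))
        (∑-* (𝟙 (P (suc a))) (prefSets N M) _))

pairWeight : ℕ → ℕ → (List ℕ → ℕ) → (List ℕ → ℕ) → List ℕ → List ℕ → ℕ
pairWeight r s F G u v = (𝟙 (length u ≡ᵇ r) * F u) * (𝟙 (length v ≡ᵇ s) * G v)

module _ (P : ℕ → Bool) (M : ℕ) where

  ∑-partition : ℕ → (List ℕ → List ℕ → ℕ) → ℕ
  ∑-partition N Φ = ∑[ b ∈ prefSets N M ] Φ (filterᵇ P b) (filterᵇ (not ∘ P) b)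

  ∑-partition-suc : ∀ N Φ → ∑-partition (suc N) Φ ≡
      ∑[ a < M ] 𝟙 (P (suc a)) * ∑-partition N (λ u v → Φ (suc a ∷ u) v)
    + ∑[ a < M ] 𝟙 (not (P (suc a))) * ∑-partition N (λ u v → Φ u (suc a ∷ v))
  ∑-partition-suc N Φ = begin
    ∑-partition (suc N) Φ
      ≡⟨ ∑-prefSets-suc N M _ ⟩
    ∑[ a < M ] ∑[ b ∈ prefSets N M ] Φ (filterᵇ P (suc a ∷ b)) (filterᵇ (not ∘ P) (suc a ∷ b))
      ≡⟨ ∑<-cong M (λ {a} _ → byFirstLetter a) ⟩
    ∑[ a < M ] (𝟙 (P (suc a)) * ∑-partition N (λ u v → Φ (suc a ∷ u) v)
              + 𝟙 (not (P (suc a))) * ∑-partition N (λ u v → Φ u (suc a ∷ v)))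
      ≡⟨ ∑<-+ M _ _ ⟩
    _ ∎
    where
    byFirstLetter : ∀ a →
      ∑[ b ∈ prefSets N M ] Φ (filterᵇ P (suc a ∷ b)) (filterᵇ (not ∘ P) (suc a ∷ b))
        ≡ 𝟙 (P (suc a)) * ∑-partition N (λ u v → Φ (suc a ∷ u) v)
        + 𝟙 (not (P (suc a))) * ∑-partition N (λ u v → Φ u (suc a ∷ v))
    byFirstLetter a with P (suc a)
    ... | true = sym (trans (+-identityʳ _) (+-identityʳ _))
    ... | false = sym (+-identityʳ _)

  private
    branchP-zero : ∀ N s F G →
      ∑[ a < M ] 𝟙 (P (suc a)) * ∑-partition N (λ u v → pairWeight 0 s F G (suc a ∷ u) v) ≡ 0
    branchP-zero N s F G = ∑<-zero M λ {a} _ →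
      trans (cong (𝟙 (P (suc a)) *_) (∑-zero (prefSets N M))) (*-zeroʳ (𝟙 (P (suc a))))

    branch¬P-zero : ∀ N r F G →
      ∑[ a < M ] 𝟙 (not (P (suc a))) * ∑-partition N (λ u v → pairWeight r 0 F G u (suc a ∷ v)) ≡ 0
    branch¬P-zero N r F G = ∑<-zero M λ {a} _ →
      trans (cong (𝟙 (not (P (suc a))) *_)
                  (trans (∑-ext (prefSets N M) (λ b → *-zeroʳ (𝟙 (length (filterᵇ P b) ≡ᵇ r) * _)))
                         (∑-zero (prefSets N M))))
            (*-zeroʳ (𝟙 (not (P (suc a)))))

    branchP-suc : ∀ N r s F G c →
      (∀ F' → ∑-partition N (pairWeight r s F' G) ≡ c * ∑All P r M F' * ∑All (not ∘ P) s M G) →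
      ∑[ a < M ] 𝟙 (P (suc a)) * ∑-partition N (λ u v → pairWeight (suc r) s F G (suc a ∷ u) v)
        ≡ c * ∑All P (suc r) M F * ∑All (not ∘ P) s M G
    branchP-suc N r s F G c ih = begin
      ∑[ a < M ] 𝟙 (P (suc a)) * ∑-partition N (pairWeight r s (F ∘ (suc a ∷_)) G)
        ≡⟨ ∑<-cong M (λ {a} _ → trans (cong (𝟙 (P (suc a)) *_) (ih (F ∘ (suc a ∷_))))
                                      (reorder (𝟙 (P (suc a))) c (∑All P r M (F ∘ (suc a ∷_))) B)) ⟩
      ∑[ a < M ] (c * B) * (𝟙 (P (suc a)) * ∑All P r M (F ∘ (suc a ∷_)))
        ≡⟨ ∑<-* M (c * B) _ ⟩
      c * B * (∑[ a < M ] 𝟙 (P (suc a)) * ∑All P r M (F ∘ (suc a ∷_)))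
        ≡⟨ cong (c * B *_) (∑All-suc P r M F) ⟨
      c * B * ∑All P (suc r) M F
        ≡⟨ *-right-comm c B _ ⟩
      c * ∑All P (suc r) M F * B ∎
      where
      B = ∑All (not ∘ P) s M G
      reorder : ∀ x c y b → x * (c * y * b) ≡ c * b * (x * y)
      reorder = solve-∀

    branch¬P-suc : ∀ N r s F G c →
      (∀ G' → ∑-partition N (pairWeight r s F G') ≡ c * ∑All P r M F * ∑All (not ∘ P) s M G') →
      ∑[ a < M ] 𝟙 (not (P (suc a))) * ∑-partition N (λ u v → pairWeight r (suc s) F G u (suc a ∷ v))
        ≡ c * ∑All P r M F * ∑All (not ∘ P) (suc s) M G
    branch¬P-suc N r s F G c ih = begin
      ∑[ a < M ] 𝟙 (not (P (suc a))) * ∑-partition N (pairWeight r s F (G ∘ (suc a ∷_)))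
        ≡⟨ ∑<-cong M (λ {a} _ → trans (cong (𝟙 (not (P (suc a))) *_) (ih (G ∘ (suc a ∷_))))
                                      (reorder (𝟙 (not (P (suc a)))) c A (∑All (not ∘ P) s M (G ∘ (suc a ∷_))))) ⟩
      ∑[ a < M ] (c * A) * (𝟙 (not (P (suc a))) * ∑All (not ∘ P) s M (G ∘ (suc a ∷_)))
        ≡⟨ ∑<-* M (c * A) _ ⟩
      c * A * (∑[ a < M ] 𝟙 (not (P (suc a))) * ∑All (not ∘ P) s M (G ∘ (suc a ∷_)))
        ≡⟨ cong (c * A *_) (∑All-suc (not ∘ P) s M G) ⟨
      c * A * ∑All (not ∘ P) (suc s) M G ∎
      where
      A = ∑All P r M F
      reorder : ∀ x c a y → x * (c * a * y) ≡ c * a * (x * y)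
      reorder = solve-∀

  -- A word is determined by its P-subword, its ¬P-subword and the positions of the former.
  ∑-shuffle : ∀ r s F G → ∑-partition (r + s) (pairWeight r s F G)
                          ≡ ((r + s) C r) * ∑All P r M F * ∑All (not ∘ P) s M G
  ∑-shuffle zero zero F G = base (F []) (G [])
    where
    base : ∀ x y → 1 * x * (1 * y) + 0 ≡ 1 * (1 * x + 0) * (1 * y + 0)
    base = solve-∀
  ∑-shuffle zero (suc s) F G =
    trans (∑-partition-suc s (pairWeight 0 (suc s) F G))
          (cong₂ _+_ (branchP-zero s (suc s) F G) (branch¬P-suc s 0 s F G 1 (∑-shuffle 0 s F)))
  ∑-shuffle (suc r) zero F G = begin
    ∑-partition (suc (r + 0)) (pairWeight (suc r) 0 F G)
      ≡⟨ ∑-partition-suc (r + 0) (pairWeight (suc r) 0 F G) ⟩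
    _
      ≡⟨ cong₂ _+_ (branchP-suc (r + 0) r 0 F G ((r + 0) C r) (λ F' → ∑-shuffle r 0 F' G))
                   (branch¬P-zero (r + 0) (suc r) F G) ⟩
    ((r + 0) C r) * A * B + 0
      ≡⟨ +-identityʳ _ ⟩
    ((r + 0) C r) * A * B
      ≡⟨ cong (λ c → c * A * B) (trans ([n+0]Cn≡1 r) (sym ([n+0]Cn≡1 (suc r)))) ⟩
    ((suc r + 0) C suc r) * A * B ∎
    where
    A = ∑All P (suc r) M F
    B = ∑All (not ∘ P) 0 M G
    [n+0]Cn≡1 : ∀ n → (n + 0) C n ≡ 1
    [n+0]Cn≡1 n = trans (cong (_C n) (+-identityʳ n)) (nCn≡1 n)
  ∑-shuffle (suc r) (suc s) F G = begin
    ∑-partition (suc (r + suc s)) (pairWeight (suc r) (suc s) F G)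
      ≡⟨ ∑-partition-suc (r + suc s) (pairWeight (suc r) (suc s) F G) ⟩
    _
      ≡⟨ cong₂ _+_ (branchP-suc (r + suc s) r (suc s) F G C₁ (λ F' → ∑-shuffle r (suc s) F' G))
                   (branch¬P-suc (r + suc s) (suc r) s F G C₂ λ G' →
                      subst (λ N → ∑-partition N (pairWeight (suc r) s F G') ≡ C₂ * A * ∑All (not ∘ P) s M G')
                            (sym (+-suc r s)) (∑-shuffle (suc r) s F G')) ⟩
    C₁ * A * B + C₂ * A * B
      ≡⟨ *-distribʳ-+ B (C₁ * A) (C₂ * A) ⟨
    (C₁ * A + C₂ * A) * B
      ≡⟨ cong (_* B) (*-distribʳ-+ A C₁ C₂) ⟨
    (C₁ + C₂) * A * B
      ≡⟨ cong (λ c → c * A * B) pascal ⟩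
    (suc (r + suc s) C suc r) * A * B ∎
    where
    A = ∑All P (suc r) M F
    B = ∑All (not ∘ P) (suc s) M G
    C₁ = (r + suc s) C r
    C₂ = (suc r + s) C suc r
    pascal : C₁ + C₂ ≡ suc (r + suc s) C suc r
    pascal = trans (cong (λ n → C₁ + n C suc r) (sym (+-suc r s))) (nCk+nC[k+1]≡[n+1]C[k+1] (r + suc s) r)

inWindow : ℕ → ℕ → ℕ → Bool
inWindow l R a = (l <ᵇ a) ∧ (a ≤ᵇ l + R)

all-inWindow : ∀ l R u → All (_≤ l + R) u → all (inWindow l R) u ≡ all (l <ᵇ_) u
all-inWindow l R [] [] = refl
all-inWindow l R (a ∷ u) (a≤ ∷ as≤)
  rewrite to T-≡ (≤⇒≤ᵇ a≤) | ∧-identityʳ (l <ᵇ a) = cong ((l <ᵇ a) ∧_) (all-inWindow l R u as≤)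

∑-window : ∀ N l R e (h : List ℕ → ℕ) →
  ∑All (inWindow l R) N (l + R + e) (h ∘ map (_∸ l)) ≡ ∑ (prefSets N R) h
∑-window zero l R e h = cong (_+ 0) (*-identityˡ (h []))
∑-window (suc N) l R e h = begin
  ∑All (inWindow l R) (suc N) (l + R + e) (h ∘ map (_∸ l))
    ≡⟨ ∑All-suc (inWindow l R) N (l + R + e) _ ⟩
  ∑[ a < l + R + e ] 𝟙 (inWindow l R (suc a)) * ∑All (inWindow l R) N (l + R + e) (h ∘ map (_∸ l) ∘ (suc a ∷_))
    ≡⟨ ∑<-cong (l + R + e) (λ {a} _ →
         cong (𝟙 (inWindow l R (suc a)) *_) (∑-window N l R e (h ∘ ((suc a ∸ l) ∷_)))) ⟩
  ∑< (l + R + e) g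
    ≡⟨ ∑<-split (l + R) e g ⟩
  ∑< (l + R) g + ∑[ d < e ] g (l + R + d)
    ≡⟨ cong₂ _+_ (∑<-split l R g) (∑<-zero e λ _ → beyond _) ⟩
  ∑< l g + ∑[ c < R ] g (l + c) + 0
    ≡⟨ +-identityʳ _ ⟩
  ∑< l g + ∑[ c < R ] g (l + c)
    ≡⟨ cong₂ _+_ (∑<-zero l below) (∑<-cong R λ c<R → inside c<R) ⟩
  ∑[ c < R ] ∑[ w ∈ prefSets N R ] h (suc c ∷ w)
    ≡⟨ ∑-prefSets-suc N R h ⟨
  ∑ (prefSets (suc N) R) h ∎
  where
  g : ℕ → ℕ
  g a = 𝟙 (inWindow l R (suc a)) * (∑[ w ∈ prefSets N R ] h ((suc a ∸ l) ∷ w))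
  below : ∀ {a} → a < l → g a ≡ 0
  below a<l rewrite <ᵇ≡false a<l = refl
  beyond : ∀ d → g (l + R + d) ≡ 0
  beyond d rewrite <ᵇ≡true (s≤s (≤-trans (m≤m+n l R) (m≤m+n (l + R) d)))
                 | <ᵇ≡false (m≤m+n (l + R) d) = refl
  inside : ∀ {c} → c < R → g (l + c) ≡ ∑[ w ∈ prefSets N R ] h (suc c ∷ w)
  inside {c} c<R rewrite <ᵇ≡true (s≤s (m≤m+n l c)) | <ᵇ≡true (+-monoʳ-< l c<R)
                       | sym (+-suc l c) | m+n∸m≡n l (suc c) = +-identityʳ _

-- A parking criterion

occupied : List Bool → ℕ
occupied [] = 0
occupied (true ∷ bs) = suc (occupied bs)
occupied (false ∷ bs) = occupied bs

dropFirstSpace : List ℕ → List ℕ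
dropFirstSpace [] = []
dropFirstSpace (zero ∷ as) = dropFirstSpace as
dropFirstSpace (suc zero ∷ as) = dropFirstSpace as
dropFirstSpace (suc (suc a) ∷ as) = suc a ∷ dropFirstSpace as

Fits : List ℕ → List Bool → Set
Fits as occ = length as + occupied occ ≤ length occ

-- On every final segment of the lot, the cars preferring a space in it fit into its free
-- spaces; dropFirstSpace renumbers the preferences for the segment starting at space 2.
Parkable : List ℕ → List Bool → Set
Parkable as [] = Fits as []
Parkable as (b ∷ bs) = Fits as (b ∷ bs) × Parkable (dropFirstSpace as) bs

parkFrom-occupies : ∀ a occ {occ'} → parkFrom (suc a) occ ≡ just occ' →
  length occ' ≡ length occ × occupied occ' ≡ suc (occupied occ)
parkFrom-occupies (suc a) (b ∷ bs) e with parkFrom (suc a) bs in e'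
parkFrom-occupies (suc a) (true ∷ bs) refl | just x =
  let (len , occ) = parkFrom-occupies a bs e' in cong suc len , cong suc occ
parkFrom-occupies (suc a) (false ∷ bs) refl | just x =
  let (len , occ) = parkFrom-occupies a bs e' in cong suc len , occ
parkFrom-occupies zero (true ∷ bs) e with parkFrom 1 bs in e'
parkFrom-occupies zero (true ∷ bs) refl | just x =
  let (len , occ) = parkFrom-occupies 0 bs e' in cong suc len , cong suc occ
parkFrom-occupies zero (false ∷ bs) refl = refl , refl

Fits-park : ∀ a as occ {occ'} → parkFrom (suc a) occ ≡ just occ' → Fits as occ' ⇔ Fits (suc a ∷ as) occ
Fits-park a as occ e rewrite proj₁ (parkFrom-occupies a occ e) | proj₂ (parkFrom-occupies a occ e)
                           | +-suc (length as) (occupied occ) = mk⇔ id id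

Parkable⇒Fits : ∀ as occ → Parkable as occ → Fits as occ
Parkable⇒Fits as [] p = p
Parkable⇒Fits as (b ∷ bs) (f , _) = f

occupied≤length : ∀ occ → occupied occ ≤ length occ
occupied≤length [] = z≤n
occupied≤length (true ∷ bs) = s≤s (occupied≤length bs)
occupied≤length (false ∷ bs) = m≤n⇒m≤1+n (occupied≤length bs)

Parkable-[] : ∀ occ → Parkable [] occ
Parkable-[] [] = z≤n
Parkable-[] (b ∷ bs) = occupied≤length (b ∷ bs) , Parkable-[] bs

Fits-uncons : ∀ c cs occ → Fits (c ∷ cs) occ → Fits cs occ
Fits-uncons c cs occ = ≤-trans (+-monoˡ-≤ (occupied occ) (n≤1+n (length cs)))

Parkable-uncons : ∀ c cs occ → Parkable (c ∷ cs) occ → Parkable cs occ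
Parkable-uncons c cs [] f = Fits-uncons c cs [] f
Parkable-uncons zero cs (b ∷ bs) (f , p) = Fits-uncons zero cs (b ∷ bs) f , p
Parkable-uncons (suc zero) cs (b ∷ bs) (f , p) = Fits-uncons 1 cs (b ∷ bs) f , p
Parkable-uncons (suc (suc c)) cs (b ∷ bs) (f , p) =
  Fits-uncons (suc (suc c)) cs (b ∷ bs) f , Parkable-uncons (suc c) (dropFirstSpace cs) bs p

-- A car preferring space 1 only enters the constraint for the whole lot.
Parkable-cons-one : ∀ as occ → Fits (1 ∷ as) occ → Parkable as occ → Parkable (1 ∷ as) occ
Parkable-cons-one as [] f _ = f
Parkable-cons-one as (b ∷ bs) f (_ , p) = f , p

length-dropFirstSpace : ∀ as → length (dropFirstSpace as) ≤ length as
length-dropFirstSpace [] = z≤n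
length-dropFirstSpace (zero ∷ as) = m≤n⇒m≤1+n (length-dropFirstSpace as)
length-dropFirstSpace (suc zero ∷ as) = m≤n⇒m≤1+n (length-dropFirstSpace as)
length-dropFirstSpace (suc (suc a) ∷ as) = s≤s (length-dropFirstSpace as)

Fits-dropFirstSpace : ∀ as bs → Fits (1 ∷ as) (true ∷ bs) → Fits (1 ∷ dropFirstSpace as) bs
Fits-dropFirstSpace as bs (s≤s f) =
  ≤-trans (s≤s (+-monoˡ-≤ (occupied bs) (length-dropFirstSpace as)))
          (subst (_≤ length bs) (+-suc (length as) (occupied bs)) f)

parkFrom-later : ∀ a b bs {x} → parkFrom (suc a) bs ≡ just x →
  parkFrom (suc (suc a)) (b ∷ bs) ≡ just (b ∷ x)
parkFrom-later a b bs e rewrite e = refl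

parkFrom-taken : ∀ bs {x} → parkFrom 1 bs ≡ just x → parkFrom 1 (true ∷ bs) ≡ just (true ∷ x)
parkFrom-taken bs e rewrite e = refl

parks⇒Parkable : ∀ a as occ {occ'} → parkFrom (suc a) occ ≡ just occ' → Parkable as occ' →
  Parkable (suc a ∷ as) occ
parks⇒Parkable (suc a) as (b ∷ bs) e p with parkFrom (suc a) bs in e'
parks⇒Parkable (suc a) as (b ∷ bs) refl (f , p) | just x =
  to (Fits-park (suc a) as (b ∷ bs) (parkFrom-later a b bs e')) f , parks⇒Parkable a (dropFirstSpace as) bs e' p
parks⇒Parkable zero as (true ∷ bs) e p with parkFrom 1 bs in e'
parks⇒Parkable zero as (true ∷ bs) refl (f , p) | just x =
  to (Fits-park 0 as (true ∷ bs) (parkFrom-taken bs e')) f ,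
  Parkable-uncons 1 (dropFirstSpace as) bs (parks⇒Parkable 0 (dropFirstSpace as) bs e' p)
parks⇒Parkable zero as (false ∷ bs) refl (f , p) = to (Fits-park 0 as (false ∷ bs) refl) f , p

Parkable⇒parks : ∀ a as occ → Parkable (suc a ∷ as) occ →
  ∃ λ occ' → parkFrom (suc a) occ ≡ just occ' × Parkable as occ'
Parkable⇒parks (suc a) as (b ∷ bs) (f , p) =
  let (x , e , q) = Parkable⇒parks a (dropFirstSpace as) bs p
      e₁ = parkFrom-later a b bs e
  in b ∷ x , e₁ , from (Fits-park (suc a) as (b ∷ bs) e₁) f , q
Parkable⇒parks zero as (true ∷ bs) (f , p) =
  let (x , e , q) = Parkable⇒parks 0 (dropFirstSpace as) bs
                      (Parkable-cons-one (dropFirstSpace as) bs (Fits-dropFirstSpace as bs f) p)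
      e₁ = parkFrom-taken bs e
  in true ∷ x , e₁ , from (Fits-park 0 as (true ∷ bs) e₁) f , q
Parkable⇒parks zero as (false ∷ bs) (f , p) = true ∷ bs , refl , from (Fits-park 0 as (false ∷ bs) refl) f , p

Positive : List ℕ → Set
Positive = All (1 ≤_)

runCars⇒Parkable : ∀ as occ {x} → Positive as → runCars as occ ≡ just x → Parkable as occ
runCars⇒Parkable [] occ [] _ = Parkable-[] occ
runCars⇒Parkable (suc a ∷ as) occ (_ ∷ pos) e with parkFrom (suc a) occ in park
... | just occ' = parks⇒Parkable a as occ park (runCars⇒Parkable as occ' pos e)

Parkable⇒runCars : ∀ as occ → Positive as → Parkable as occ → ∃ λ x → runCars as occ ≡ just x
Parkable⇒runCars [] occ [] _ = occ , refl
Parkable⇒runCars (suc a ∷ as) occ (_ ∷ pos) p with Parkable⇒parks a as occ p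
... | occ' , park , p' rewrite park = Parkable⇒runCars as occ' pos p'

isParkingFunction⇔Parkable : ∀ m as → Positive as → T (isParkingFunction m as) ⇔ Parkable as (emptyLot m)
isParkingFunction⇔Parkable m as pos = mk⇔ to′ from′
  where
  to′ : T (isParkingFunction m as) → Parkable as (emptyLot m)
  to′ t with runCars as (emptyLot m) in e
  ... | just _ = runCars⇒Parkable as (emptyLot m) pos e
  from′ : Parkable as (emptyLot m) → T (isParkingFunction m as)
  from′ p with Parkable⇒runCars as (emptyLot m) pos p
  ... | _ , e rewrite e = _

countAbove : ℕ → List ℕ → ℕ
countAbove j [] = 0
countAbove j (a ∷ as) = 𝟙 (j <ᵇ a) + countAbove j as

Uncrowded : ℕ → List ℕ → Set
Uncrowded m as = ∀ j → j ≤ m → countAbove j as + j ≤ m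

countAbove-dropFirstSpace : ∀ j as → countAbove j (dropFirstSpace as) ≡ countAbove (suc j) as
countAbove-dropFirstSpace j [] = refl
countAbove-dropFirstSpace j (zero ∷ as) = countAbove-dropFirstSpace j as
countAbove-dropFirstSpace j (suc zero ∷ as) = countAbove-dropFirstSpace j as
countAbove-dropFirstSpace j (suc (suc a) ∷ as) = cong (𝟙 (j <ᵇ suc a) +_) (countAbove-dropFirstSpace j as)

countAbove-zero : ∀ as → Positive as → countAbove 0 as ≡ length as
countAbove-zero [] [] = refl
countAbove-zero (suc a ∷ as) (_ ∷ pos) = cong suc (countAbove-zero as pos)

dropFirstSpace-positive : ∀ as → Positive (dropFirstSpace as)
dropFirstSpace-positive [] = []
dropFirstSpace-positive (zero ∷ as) = dropFirstSpace-positive as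
dropFirstSpace-positive (suc zero ∷ as) = dropFirstSpace-positive as
dropFirstSpace-positive (suc (suc a) ∷ as) = s≤s z≤n ∷ dropFirstSpace-positive as

length-emptyLot : ∀ m → length (emptyLot m) ≡ m
length-emptyLot zero = refl
length-emptyLot (suc m) = cong suc (length-emptyLot m)

occupied-emptyLot : ∀ m → occupied (emptyLot m) ≡ 0
occupied-emptyLot zero = refl
occupied-emptyLot (suc m) = occupied-emptyLot m

Fits-emptyLot : ∀ m as → Positive as → Fits as (emptyLot m) ⇔ countAbove 0 as + 0 ≤ m
Fits-emptyLot m as pos rewrite occupied-emptyLot m | length-emptyLot m | countAbove-zero as pos = mk⇔ id id

Parkable⇔Uncrowded : ∀ m as → Positive as → Parkable as (emptyLot m) ⇔ Uncrowded m as
Parkable⇔Uncrowded m as pos = mk⇔ (to′ m as pos) (from′ m as pos)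
  where
  to′ : ∀ m as → Positive as → Parkable as (emptyLot m) → Uncrowded m as
  to′ m as pos p zero _ = to (Fits-emptyLot m as pos) (Parkable⇒Fits as (emptyLot m) p)
  to′ (suc m) as pos (_ , p) (suc j) (s≤s j≤m)
    rewrite +-suc (countAbove (suc j) as) j | sym (countAbove-dropFirstSpace j as) =
    s≤s (to′ m (dropFirstSpace as) (dropFirstSpace-positive as) p j j≤m)
  from′ : ∀ m as → Positive as → Uncrowded m as → Parkable as (emptyLot m)
  from′ zero as pos u = from (Fits-emptyLot 0 as pos) (u 0 z≤n)
  from′ (suc m) as pos u =
    from (Fits-emptyLot (suc m) as pos) (u 0 z≤n) ,
    from′ m (dropFirstSpace as) (dropFirstSpace-positive as) λ j j≤m →
      ≤-pred (subst (_≤ suc m) (trans (+-suc _ j) (cong (λ c → suc (c + j)) (sym (countAbove-dropFirstSpace j as))))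
                    (u (suc j) (s≤s j≤m)))

isParkingFunction⇔Uncrowded : ∀ m as → Positive as → T (isParkingFunction m as) ⇔ Uncrowded m as
isParkingFunction⇔Uncrowded m as pos =
  mk⇔ (to (Parkable⇔Uncrowded m as pos) ∘ to (isParkingFunction⇔Parkable m as pos))
      (from (isParkingFunction⇔Parkable m as pos) ∘ from (Parkable⇔Uncrowded m as pos))

Uncrowded⇒length≤ : ∀ m u → Positive u → Uncrowded m u → length u ≤ m
Uncrowded⇒length≤ m u pos un = subst (_≤ m) (trans (+-identityʳ _) (countAbove-zero u pos)) (un 0 z≤n)

countAbove≤0⇒All≤ : ∀ j v → countAbove j v ≤ 0 → All (_≤ j) v
countAbove≤0⇒All≤ j [] _ = []
countAbove≤0⇒All≤ j (a ∷ v) c with j <ᵇ a | <ᵇ-reflects-< j a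
... | false | ofⁿ j≮a = ≮⇒≥ j≮a ∷ countAbove≤0⇒All≤ j v c

Uncrowded⇒All≤ : ∀ m v → Uncrowded m v → All (_≤ m) v
Uncrowded⇒All≤ m v u = countAbove≤0⇒All≤ m v (+-cancelʳ-≤ m _ 0 (u m ≤-refl))

-- Splitting a preference list at a threshold

countAbove-filter : ∀ (P : ℕ → Bool) j b →
  countAbove j b ≡ countAbove j (filterᵇ P b) + countAbove j (filterᵇ (not ∘ P) b)
countAbove-filter P j [] = refl
countAbove-filter P j (a ∷ b) with P a
... | true = trans (cong (𝟙 (j <ᵇ a) +_) (countAbove-filter P j b)) (sym (+-assoc (𝟙 (j <ᵇ a)) _ _))
... | false = trans (cong (𝟙 (j <ᵇ a) +_) (countAbove-filter P j b))
                   (x∙yz≈y∙xz (𝟙 (j <ᵇ a)) (countAbove j (filterᵇ P b)) _)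

length-filter-partition : ∀ (P : ℕ → Bool) b →
  length (filterᵇ P b) + length (filterᵇ (not ∘ P) b) ≡ length b
length-filter-partition P [] = refl
length-filter-partition P (a ∷ b) with P a
... | true = cong suc (length-filter-partition P b)
... | false = trans (+-suc _ _) (cong suc (length-filter-partition P b))

countAbove-all> : ∀ j u → All (j <_) u → countAbove j u ≡ length u
countAbove-all> j [] [] = refl
countAbove-all> j (a ∷ u) (j<a ∷ js) rewrite <ᵇ≡true j<a = cong suc (countAbove-all> j u js)

countAbove-all≤ : ∀ j u → All (_≤ j) u → countAbove j u ≡ 0
countAbove-all≤ j [] [] = refl
countAbove-all≤ j (a ∷ u) (a≤j ∷ js) rewrite <ᵇ≡false a≤j = countAbove-all≤ j u js

countAbove-shift : ∀ t l u → countAbove (t + l) u ≡ countAbove t (map (_∸ l) u)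
countAbove-shift t l [] = refl
countAbove-shift t l (a ∷ u) = cong₂ _+_ (cong 𝟙 (<ᵇ-shift t l a)) (countAbove-shift t l u)

Uncrowded-lowerHead : ∀ m {x y} b → x ≤ y → Uncrowded m (y ∷ b) → Uncrowded m (x ∷ b)
Uncrowded-lowerHead m b x≤y u j j≤m =
  ≤-trans (+-monoˡ-≤ j (+-monoˡ-≤ (countAbove j b) (𝟙-<ᵇ-mono j x≤y))) (u j j≤m)

Uncrowded-suc-head : ∀ m x b → x ≤ m →
  Uncrowded m (suc x ∷ b) ⇔ (Uncrowded m (x ∷ b) × countAbove x b + x < m)
Uncrowded-suc-head m x b x≤m = mk⇔
  (λ u → Uncrowded-lowerHead m b (n≤1+n x) u ,
         subst (λ c → 𝟙 c + countAbove x b + x ≤ m) (<ᵇ≡true (n<1+n x)) (u x x≤m))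
  (λ (u , bound) → raise u bound)
  where
  raise : Uncrowded m (x ∷ b) → countAbove x b + x < m → Uncrowded m (suc x ∷ b)
  raise u bound j j≤m with j ≟ x
  ... | yes refl rewrite <ᵇ≡true (n<1+n j) = bound
  ... | no j≢x rewrite <ᵇ-suc j≢x = u j j≤m

low-bound : ∀ r c j L → suc (r + c) + j ≤ suc L + r ⇔ c + j ≤ L
low-bound r c j L rewrite +-assoc r c j | +-comm L r =
  mk⇔ (+-cancelˡ-≤ r _ _ ∘ ≤-pred) (s≤s ∘ +-monoʳ-≤ r)

high-bound : ∀ c t T r → c + (t + T) ≤ T + r ⇔ c + t ≤ r
high-bound c t T r rewrite sym (+-assoc c t T) | +-comm T r = mk⇔ (+-cancelʳ-≤ T _ _) (+-monoˡ-≤ T)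

module SplitAt (L : ℕ) where

  above : List ℕ → List ℕ
  above = filterᵇ (suc L <ᵇ_)

  atMost : List ℕ → List ℕ
  atMost = filterᵇ (not ∘ (suc L <ᵇ_))

  lowered : List ℕ → List ℕ
  lowered b = map (_∸ suc L) (above b)

  above-all : ∀ b → All (suc L <_) (above b)
  above-all b = All.map (<ᵇ⇒< (suc L) _) (all-filter (T? ∘ (suc L <ᵇ_)) b)

  atMost-all : ∀ b → All (_≤ suc L) (atMost b)
  atMost-all b =
    All.map (λ t → ≮⇒≥ λ lt → subst T (to T-not-≡ t) (<⇒<ᵇ lt)) (all-filter (T? ∘ (not ∘ (suc L <ᵇ_))) b)

  lowered-positive : ∀ b → Positive (lowered b)
  lowered-positive b = All.map⁺ (All.map (m+n≤o⇒m≤o∸n 1) (above-all b))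

  countAbove-low : ∀ j b → j ≤ L → countAbove j b ≡ length (above b) + countAbove j (atMost b)
  countAbove-low j b j≤L = trans (countAbove-filter (suc L <ᵇ_) j b)
    (cong (_+ countAbove j (atMost b)) (countAbove-all> j (above b) (All.map (<-trans (s≤s j≤L)) (above-all b))))

  countAbove-high : ∀ t b → countAbove (t + suc L) b ≡ countAbove t (lowered b)
  countAbove-high t b = begin
    countAbove (t + suc L) b
      ≡⟨ countAbove-filter (suc L <ᵇ_) (t + suc L) b ⟩
    countAbove (t + suc L) (above b) + countAbove (t + suc L) (atMost b)
      ≡⟨ cong (countAbove (t + suc L) (above b) +_)
              (countAbove-all≤ (t + suc L) (atMost b)
                               (All.map (λ a≤ → ≤-trans a≤ (m≤n+m (suc L) t)) (atMost-all b))) ⟩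
    countAbove (t + suc L) (above b) + 0
      ≡⟨ +-identityʳ _ ⟩
    countAbove (t + suc L) (above b)
      ≡⟨ countAbove-shift t (suc L) (above b) ⟩
    countAbove t (lowered b) ∎

  countAbove-threshold : ∀ b → countAbove (suc L) b ≡ length (above b)
  countAbove-threshold b =
    trans (countAbove-high 0 b)
          (trans (countAbove-zero (lowered b) (lowered-positive b)) (length-map (_∸ suc L) (above b)))

  module _ (r : ℕ) (b : List ℕ) where

    Uncrowded-low : length (above b) ≡ r → ∀ j → j ≤ L →
      countAbove j (suc L ∷ b) + j ≤ suc L + r ⇔ countAbove j (atMost b) + j ≤ L
    Uncrowded-low len j j≤L rewrite <ᵇ≡true (s≤s j≤L) | countAbove-low j b j≤L | len =
      low-bound r (countAbove j (atMost b)) j L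

    Uncrowded-high : ∀ t →
      countAbove (t + suc L) (suc L ∷ b) + (t + suc L) ≤ suc L + r ⇔ countAbove t (lowered b) + t ≤ r
    Uncrowded-high t rewrite <ᵇ≡false (m≤n+m (suc L) t) | countAbove-high t b =
      high-bound (countAbove t (lowered b)) t (suc L) r

    Uncrowded⇒lowered : Uncrowded (suc L + r) (suc L ∷ b) → Uncrowded r (lowered b)
    Uncrowded⇒lowered u t t≤r =
      to (Uncrowded-high t) (u (t + suc L) (subst (t + suc L ≤_) (+-comm r (suc L)) (+-monoˡ-≤ (suc L) t≤r)))

    Uncrowded⇒atMost : Uncrowded (suc L + r) (suc L ∷ b) → length (above b) ≡ r → Uncrowded L (atMost b)
    Uncrowded⇒atMost u len j j≤L =
      to (Uncrowded-low len j j≤L) (u j (≤-trans (m≤n⇒m≤1+n j≤L) (m≤m+n (suc L) r)))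

    lowered-atMost⇒Uncrowded : length (above b) ≡ r → Uncrowded r (lowered b) → Uncrowded L (atMost b) →
      Uncrowded (suc L + r) (suc L ∷ b)
    lowered-atMost⇒Uncrowded len ul ua j j≤M with j ≤? L
    ... | yes j≤L = from (Uncrowded-low len j j≤L) (ua j j≤L)
    ... | no j≰L = subst (λ j → countAbove j (suc L ∷ b) + j ≤ suc L + r) (m∸n+n≡m L<j)
                         (from (Uncrowded-high t) (ul t t≤r))
      where
      L<j = ≰⇒> j≰L
      t = j ∸ suc L
      t≤r : t ≤ r
      t≤r = subst (t ≤_) (m+n∸m≡n (suc L) r) (∸-monoˡ-≤ (suc L) j≤M)

    Uncrowded-next :
      Uncrowded (suc L + r) (suc (suc L) ∷ b) ⇔ (Uncrowded (suc L + r) (suc L ∷ b) × length (above b) < r)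
    Uncrowded-next = mk⇔ (map₂ (to bound) ∘ to next) (from next ∘ map₂ (from bound))
      where
      next = Uncrowded-suc-head (suc L + r) (suc L) b (m≤m+n (suc L) r)
      bound : countAbove (suc L) b + suc L < suc L + r ⇔ length (above b) < r
      bound rewrite countAbove-threshold b = high-bound 1 (length (above b)) (suc L) r

    Uncrowded-exactly : (Uncrowded (suc L + r) (suc L ∷ b) × ¬ Uncrowded (suc L + r) (suc (suc L) ∷ b))
      ⇔ (length (above b) ≡ r × Uncrowded r (lowered b) × Uncrowded L (atMost b))
    Uncrowded-exactly = mk⇔
      (λ (x , ¬y) → let len = ≤-antisym (length≤ x) (≮⇒≥ λ short → ¬y (from Uncrowded-next (x , short)))
                    in len , Uncrowded⇒lowered x , Uncrowded⇒atMost x len)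
      (λ (len , ul , ua) →
         lowered-atMost⇒Uncrowded len ul ua , λ y → <-irrefl len (proj₂ (to Uncrowded-next y)))
      where
      length≤ : Uncrowded (suc L + r) (suc L ∷ b) → length (above b) ≤ r
      length≤ x = subst (_≤ r) (length-map (_∸ suc L) (above b))
                        (Uncrowded⇒length≤ r (lowered b) (lowered-positive b) (Uncrowded⇒lowered x))

-- Fixing the first preference

𝟙PF : ℕ → List ℕ → ℕ
𝟙PF m = 𝟙 ∘ isParkingFunction m

module _ (L r s : ℕ) where
  open SplitAt L

  𝟙-firstPreference : ∀ b → Positive b → length b ≡ r + s →
    𝟙 (isParkingFunction (suc L + r) (suc L ∷ b))
      ≡ 𝟙 (isParkingFunction (suc L + r) (suc (suc L) ∷ b))
        + pairWeight r s (𝟙PF r ∘ map (_∸ suc L)) (𝟙PF L) (above b) (atMost b)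
  𝟙-firstPreference b pos len = trans (𝟙-split x y e y⇒x e⇔) (cong (𝟙 y +_) 𝟙e)
    where
    M = suc L + r
    x = isParkingFunction M (suc L ∷ b)
    y = isParkingFunction M (suc (suc L) ∷ b)
    lenAbove = length (above b) ≡ᵇ r
    lenAtMost = length (atMost b) ≡ᵇ s
    e = (lenAbove ∧ isParkingFunction r (lowered b)) ∧ (lenAtMost ∧ isParkingFunction L (atMost b))
    𝟙e : 𝟙 e ≡ pairWeight r s (𝟙PF r ∘ map (_∸ suc L)) (𝟙PF L) (above b) (atMost b)
    𝟙e = trans (𝟙-∧ (lenAbove ∧ isParkingFunction r (lowered b)) (lenAtMost ∧ isParkingFunction L (atMost b)))
               (cong₂ _*_ (𝟙-∧ lenAbove _) (𝟙-∧ lenAtMost _))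
    critX = isParkingFunction⇔Uncrowded M (suc L ∷ b) (s≤s z≤n ∷ pos)
    critY = isParkingFunction⇔Uncrowded M (suc (suc L) ∷ b) (s≤s z≤n ∷ pos)
    critLowered = isParkingFunction⇔Uncrowded r (lowered b) (lowered-positive b)
    critAtMost = isParkingFunction⇔Uncrowded L (atMost b) (filter⁺ (T? ∘ (not ∘ (suc L <ᵇ_))) pos)
    y⇒x : T y → T x
    y⇒x = from critX ∘ Uncrowded-lowerHead M b (n≤1+n (suc L)) ∘ to critY
    lenAtMost≡ : length (above b) ≡ r → length (atMost b) ≡ s
    lenAtMost≡ lenA = +-cancelˡ-≡ r _ _
      (trans (cong (_+ length (atMost b)) (sym lenA)) (trans (length-filter-partition (suc L <ᵇ_) b) len))
    parts : T e → length (above b) ≡ r × T (isParkingFunction r (lowered b)) × T (isParkingFunction L (atMost b))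
    parts te with to T-∧ te
    ... | tAl , tSt with to T-∧ tAl | to T-∧ tSt
    ... | tA , tl | _ , ta = to (T-≡ᵇ _ _) tA , tl , ta
    fromParts : length (above b) ≡ r → T (isParkingFunction r (lowered b)) → T (isParkingFunction L (atMost b)) →
                T e
    fromParts lenA tl ta =
      from T-∧ (from T-∧ (from (T-≡ᵇ _ _) lenA , tl) , from T-∧ (from (T-≡ᵇ _ _) (lenAtMost≡ lenA) , ta))
    e⇔ : T e ⇔ (T x × ¬ T y)
    e⇔ = mk⇔
      (λ te → let (lenA , tl , ta) = parts te
                  (ux , ¬uy) = from (Uncrowded-exactly r b) (lenA , to critLowered tl , to critAtMost ta)
              in from critX ux , ¬uy ∘ to critY)
      (λ (tx , ¬ty) → let (lenA , ul , ua) = to (Uncrowded-exactly r b) (to critX tx , ¬ty ∘ from critY)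
                      in fromParts lenA (from critLowered ul) (from critAtMost ua))

pˡ≤≡∑ : ∀ L N M → L < M →
  pˡ≤ (suc L) (suc N) M M ≡ ∑[ b ∈ prefSets N M ] 𝟙 (isParkingFunction M (suc L ∷ b))
pˡ≤≡∑ L N M L<M = begin
  pˡ≤ (suc L) (suc N) M M
    ≡⟨ countTrue≡∑ _ (prefSets (suc N) M) ⟩
  ∑[ as ∈ prefSets (suc N) M ] 𝟙 (if firstIs (suc L) as then isParkingFunction M as else false)
    ≡⟨ ∑-prefSets-suc N M _ ⟩
  ∑[ a < M ] ∑[ b ∈ prefSets N M ] 𝟙 (if firstIs (suc L) (suc a ∷ b) then isParkingFunction M (suc a ∷ b) else false)
    ≡⟨ ∑<-single M L L<M (λ _ a≢L →
         trans (∑-ext (prefSets N M) (otherFirst a≢L)) (∑-zero (prefSets N M))) ⟩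
  ∑[ b ∈ prefSets N M ] 𝟙 (if firstIs (suc L) (suc L ∷ b) then isParkingFunction M (suc L ∷ b) else false)
    ≡⟨ ∑-ext (prefSets N M) sameFirst ⟩
  ∑[ b ∈ prefSets N M ] 𝟙 (isParkingFunction M (suc L ∷ b)) ∎
  where
  otherFirst : ∀ {a} → a ≢ L → ∀ b →
    𝟙 (if firstIs (suc L) (suc a ∷ b) then isParkingFunction M (suc a ∷ b) else false) ≡ 0
  otherFirst {a} a≢L b with suc a ≟ suc L
  ... | yes a+1≡L+1 = contradiction (suc-injective a+1≡L+1) a≢L
  ... | no _ = refl
  sameFirst : ∀ b → 𝟙 (if firstIs (suc L) (suc L ∷ b) then isParkingFunction M (suc L ∷ b) else false)
                  ≡ 𝟙 (isParkingFunction M (suc L ∷ b))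
  sameFirst b with suc L ≟ suc L
  ... | yes _ = refl
  ... | no L≢L = contradiction refl L≢L

∑All-above : ∀ L r → ∑All (suc L <ᵇ_) r (suc L + r) (𝟙PF r ∘ map (_∸ suc L)) ≡ pPF r
∑All-above L r = begin
  ∑All (suc L <ᵇ_) r (suc L + r) (𝟙PF r ∘ map (_∸ suc L))
    ≡⟨ ∑-cong (prefSets r (suc L + r)) (prefSets-Word r (suc L + r))
              (λ {u} (_ , letters) → cong (λ c → 𝟙 c * (𝟙PF r ∘ map (_∸ suc L)) u)
                                          (sym (all-inWindow (suc L) r u (All.map proj₂ letters)))) ⟩
  ∑All (inWindow (suc L) r) r (suc L + r) (𝟙PF r ∘ map (_∸ suc L))
    ≡⟨ cong (λ M → ∑All (inWindow (suc L) r) r M (𝟙PF r ∘ map (_∸ suc L))) (sym (+-identityʳ (suc L + r))) ⟩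
  ∑All (inWindow (suc L) r) r (suc L + r + 0) (𝟙PF r ∘ map (_∸ suc L))
    ≡⟨ ∑-window r (suc L) r 0 (𝟙PF r) ⟩
  ∑[ u ∈ prefSets r r ] 𝟙 (isParkingFunction r u)
    ≡⟨ countTrue≡∑ (isParkingFunction r) (prefSets r r) ⟨
  pPF r ∎

∑All-atMost : ∀ L r s → ∑All (not ∘ (suc L <ᵇ_)) s (suc L + r) (𝟙PF L) ≡ p≤ s L L
∑All-atMost L r s = begin
  ∑All (not ∘ (suc L <ᵇ_)) s (suc L + r) (𝟙PF L)
    ≡⟨ ∑-cong (prefSets s (suc L + r)) (prefSets-Word s (suc L + r))
              (λ {v} (_ , letters) → onlyParkingFunctions v (All.map proj₁ letters)) ⟩
  ∑All (inWindow 0 L) s (suc L + r) (𝟙PF L ∘ map (_∸ 0))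
    ≡⟨ cong (λ M → ∑All (inWindow 0 L) s M (𝟙PF L ∘ map (_∸ 0))) (sym (+-suc L r)) ⟩
  ∑All (inWindow 0 L) s (0 + L + suc r) (𝟙PF L ∘ map (_∸ 0))
    ≡⟨ ∑-window s 0 L (suc r) (𝟙PF L) ⟩
  ∑[ v ∈ prefSets s L ] 𝟙 (isParkingFunction L v)
    ≡⟨ countTrue≡∑ (isParkingFunction L) (prefSets s L) ⟨
  p≤ s L L ∎
  where
  ≤L : ∀ v → Positive v → isParkingFunction L v ≡ true → All (_≤ L) v
  ≤L v pos pf = Uncrowded⇒All≤ L v (to (isParkingFunction⇔Uncrowded L v pos) (from T-≡ pf))
  onlyParkingFunctions : ∀ v → Positive v →
    𝟙 (all (not ∘ (suc L <ᵇ_)) v) * 𝟙PF L v ≡ 𝟙 (all (inWindow 0 L) v) * 𝟙PF L (map (_∸ 0) v)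
  onlyParkingFunctions v pos rewrite map-id v with isParkingFunction L v in pf
  ... | false = trans (*-zeroʳ (𝟙 (all (not ∘ (suc L <ᵇ_)) v))) (sym (*-zeroʳ (𝟙 (all (inWindow 0 L) v))))
  ... | true
    rewrite all≡true (not ∘ (suc L <ᵇ_)) v (All.map (λ a≤L → cong not (<ᵇ≡false (m≤n⇒m≤1+n a≤L))) (≤L v pos pf))
          | all≡true (inWindow 0 L) v
              (All.zipWith (λ (0<a , a≤L) → cong₂ _∧_ (<ᵇ≡true 0<a) (to T-≡ (≤⇒≤ᵇ a≤L))) (pos , ≤L v pos pf))
          = refl

firstPreference-step : ∀ L r s → 0 < r →
  pˡ≤ (suc L) (suc (r + s)) (suc L + r) (suc L + r)
    ≡ pˡ≤ (suc (suc L)) (suc (r + s)) (suc L + r) (suc L + r) + ((r + s) C s) * p≤ s L L * pPF r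
firstPreference-step L r s r>0 = begin
  pˡ≤ (suc L) (suc (r + s)) M M
    ≡⟨ pˡ≤≡∑ L (r + s) M (m≤m+n (suc L) r) ⟩
  ∑[ b ∈ prefSets (r + s) M ] 𝟙 (isParkingFunction M (suc L ∷ b))
    ≡⟨ ∑-cong (prefSets (r + s) M) (prefSets-Word (r + s) M)
              (λ {b} (len , letters) → 𝟙-firstPreference L r s b (All.map proj₁ letters) len) ⟩
  ∑[ b ∈ prefSets (r + s) M ] (𝟙 (isParkingFunction M (suc (suc L) ∷ b))
                               + pairWeight r s F G (above b) (atMost b))
    ≡⟨ ∑-+ (prefSets (r + s) M) _ _ ⟩
  ∑[ b ∈ prefSets (r + s) M ] 𝟙 (isParkingFunction M (suc (suc L) ∷ b))
    + ∑-partition P M (r + s) (pairWeight r s F G)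
    ≡⟨ cong₂ _+_ (sym (pˡ≤≡∑ (suc L) (r + s) M (s≤s (m<m+n L r>0)))) (∑-shuffle P M r s F G) ⟩
  pˡ≤ (suc (suc L)) (suc (r + s)) M M + ((r + s) C r) * ∑All P r M F * ∑All (not ∘ P) s M G
    ≡⟨ cong (pˡ≤ (suc (suc L)) (suc (r + s)) M M +_) (begin
         ((r + s) C r) * ∑All P r M F * ∑All (not ∘ P) s M G
           ≡⟨ cong₂ (λ c x → c * x * ∑All (not ∘ P) s M G) C-symmetric (∑All-above L r) ⟩
         ((r + s) C s) * pPF r * ∑All (not ∘ P) s M G
           ≡⟨ cong (((r + s) C s) * pPF r *_) (∑All-atMost L r s) ⟩
         ((r + s) C s) * pPF r * p≤ s L L
           ≡⟨ *-right-comm ((r + s) C s) (pPF r) (p≤ s L L) ⟩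
         ((r + s) C s) * p≤ s L L * pPF r ∎) ⟩
  pˡ≤ (suc (suc L)) (suc (r + s)) M M + ((r + s) C s) * p≤ s L L * pPF r ∎
  where
  M = suc L + r
  P = suc L <ᵇ_
  F = 𝟙PF r ∘ map (_∸ suc L)
  G = 𝟙PF L
  open SplitAt L
  C-symmetric : (r + s) C r ≡ (r + s) C s
  C-symmetric = trans (nCk≡nC[n∸k] (m≤m+n r s)) (cong ((r + s) C_) (m+n∸m≡n r s))

[m∸n]+[n∸o]≡m∸o : ∀ {m n o} → o ≤ n → n ≤ m → (m ∸ n) + (n ∸ o) ≡ m ∸ o
[m∸n]+[n∸o]≡m∸o {m} {n} {o} o≤n n≤m = +-cancelʳ-≡ o _ _ (begin
  m ∸ n + (n ∸ o) + o   ≡⟨ +-assoc (m ∸ n) (n ∸ o) o ⟩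
  m ∸ n + (n ∸ o + o)   ≡⟨ cong (m ∸ n +_) (m∸n+n≡m o≤n) ⟩
  m ∸ n + n             ≡⟨ m∸n+n≡m n≤m ⟩
  m                     ≡⟨ m∸n+n≡m (≤-trans o≤n n≤m) ⟨
  m ∸ o + o             ∎)

open import Data.Integer using (+_; _-_)
open import Data.Integer.Properties using (m-n≡m⊖n; ⊖-≥)

+x-+y≡+z : ∀ {x y z} → x ≡ y + z → (+ x) - (+ y) ≡ + z
+x-+y≡+z {x} {y} {z} refl = trans (m-n≡m⊖n (y + z) y) (trans (⊖-≥ (m≤m+n y z)) (cong +_ (m+n∸m≡n y z)))

firstPreference-difference : ∀ n k L → k ≤ L → L < n + k →
  (+ pˡ≤ (suc L) (suc n) (suc n + k) (suc n + k)) - (+ pˡ≤ (suc (suc L)) (suc n) (suc n + k) (suc n + k))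
    ≡ + ((n C (L ∸ k)) * p≤ (L ∸ k) L L * pPF (n + k ∸ L))
firstPreference-difference n k L k≤L L<n+k =
  subst₂ (λ N M → (+ pˡ≤ (suc L) (suc N) M M) - (+ pˡ≤ (suc (suc L)) (suc N) M M)
                     ≡ + ((N C s) * p≤ s L L * pPF r))
         r+s≡n (cong suc (m+[n∸m]≡n (<⇒≤ L<n+k)))
         (+x-+y≡+z (firstPreference-step L r s (m<n⇒0<n∸m L<n+k)))
  where
  r = n + k ∸ L
  s = L ∸ k
  r+s≡n : r + s ≡ n
  r+s≡n = trans ([m∸n]+[n∸o]≡m∸o k≤L (<⇒≤ L<n+k)) (m+n∸n≡m n k)

theorem4p3 : (n k l : ℕ) → 1 ≤ n → k + 1 ≤ l → l ≤ n + k ∸ 1 →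
    (+ pˡ≤ l n (n + k) (n + k)) - (+ pˡ≤ (suc l) n (n + k) (n + k))
      ≡ + (((n ∸ 1) C (l ∸ k ∸ 1)) * p≤ (l ∸ k ∸ 1) (l ∸ 1) (l ∸ 1) * pPF (n + k ∸ l))
theorem4p3 (suc n) k zero _ k+1≤0 _ = contradiction (subst (_≤ 0) (+-comm k 1) k+1≤0) λ ()
theorem4p3 (suc n) k (suc L) _ k+1≤l L<n+k =
  trans (firstPreference-difference n k L k≤L L<n+k)
        (cong (λ t → + ((n C t) * p≤ t L L * pPF (n + k ∸ L))) (sym (cong (_∸ 1) (+-∸-assoc 1 k≤L))))
  where
  k≤L : k ≤ L
  k≤L = ≤-pred (subst (_≤ suc L) (+-comm k 1) k+1≤l)
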